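{- For every integer $n \ge 0$, $M(n) \ge p_{\mathbb P}(n)$.
   Context: For a partition $\lambda = (\lambda_1,\dots,\lambda_r)$ of $n$ (positive integer parts summing to $n$), its multinomial coefficient is $\binom{n}{\lambda_1,\dots,\lambda_r} = n!/(\lambda_1!\cdots\lambda_r!)$. $M(n)$ denotes the number of distinct values taken by these multinomial coefficients as $\lambda$ ranges over all partitions of $n$. $p_{\mathbb P}(n)$ denotes the number of partitions of $n$ all of whose parts are prime numbers. -}

module Defs where

open import Data.Nat using (ℕ; zero; suc; _+_; _*_; _∸_; _⊓_; _/_; _!; NonZero)
open import Data.Nat.Properties using (_≟_; m*n≢0; _!≢0)
open import Data.Nat.Primality using (Prime; prime?)
open import Data.List using (List; []; _∷_; _++_; map; concatMap; length; filter; deduplicate; upTo)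
open import Data.List.Relation.Unary.All using (All; all?)

-- A partition of n is represented as a list of positive parts in
-- non-increasing order (λ₁ ≥ λ₂ ≥ … ≥ λᵣ ≥ 1) summing to n.

-- parts f n k : all partitions of n with every part ≤ k, each exactly once,
-- provided the fuel f is ≥ n (each step removes a part ≥ 1 from n).
-- The first (largest) part j ranges over 1 … min(k, n); the rest is a
-- partition of n ∸ j with parts ≤ j.
parts : ℕ → ℕ → ℕ → List (List ℕ)
parts _       zero    _ = [] ∷ []
parts zero    (suc _) _ = []
parts (suc f) (suc n) k =
  concatMap (λ i → map (suc i ∷_) (parts f (suc n ∸ suc i) (suc i))) (upTo (k ⊓ suc n))

partitions : ℕ → List (List ℕ)
partitions n = parts n n n

factProd : List ℕ → ℕ
factProd [] = 1
factProd (x ∷ xs) = x ! * factProd xs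

factProd≢0 : ∀ xs → NonZero (factProd xs)
factProd≢0 [] = _
factProd≢0 (x ∷ xs) = m*n≢0 (x !) (factProd xs) {{x !≢0}} {{factProd≢0 xs}}

multinomial : ℕ → List ℕ → ℕ
multinomial n λs = (n ! / factProd λs) {{factProd≢0 λs}}

M : ℕ → ℕ
M n = length (deduplicate _≟_ (map (multinomial n) (partitions n)))

pPrime : ℕ → ℕ
pPrime n = length (filter (all? prime?) (partitions n))

-- The multinomial coefficient of a partition λ of n determines λ₁!⋯λᵣ! = n!/multinomial,
-- and when all parts are prime this product of factorials determines λ: the largest
-- part p divides it, while no prime larger than every part does. Hence the multinomial
-- coefficient is injective on prime partitions, which therefore yield at least
-- p_ℙ(n) distinct values.
module Submission where

open import Defs
open import Data.Nat using (ℕ; zero; suc; _+_; _*_; _∸_; _⊓_; _!; NonZero; _≤_; _≥_; _<_; z≤n; s≤s)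
open import Data.Nat.Properties
open import Data.Nat.Divisibility using (_∣_; _∤_; ∣-refl; ∣-trans; ∣⇒≤; ∣1⇒≡1; m∣m*n; *-monoʳ-∣)
open import Data.Nat.DivMod using (m/n*n≡m)
open import Data.Nat.Primality using (Prime; prime?; euclidsLemma; ¬prime[1])
open import Data.Nat.Combinatorics using (k![n∸k]!∣n!)
open import Data.Nat.ListAction using (sum)
open import Data.List using (List; []; _∷_; _++_; map; length; filter; deduplicate; upTo)
open import Data.List.Properties using (length-map; ∷-injectiveʳ)
open import Data.List.Relation.Unary.All as All using (All; all?; []; _∷_)
import Data.List.Relation.Unary.All.Properties as All
open import Data.List.Relation.Unary.Any using (here; there)
open import Data.List.Relation.Unary.AllPairs as AllPairs using (AllPairs; []; _∷_)
import Data.List.Relation.Unary.AllPairs.Properties as AllPairs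
open import Data.List.Relation.Unary.Unique.Propositional using (Unique)
import Data.List.Relation.Unary.Unique.Propositional.Properties as Unique
open import Data.List.Relation.Binary.Disjoint.Propositional using (Disjoint)
open import Data.List.Relation.Binary.Subset.Propositional using (_⊆_)
open import Data.List.Relation.Binary.Permutation.Propositional.Properties using (shift; ↭-length; ∈-resp-↭)
open import Data.List.Membership.Propositional using (_∈_; find)
open import Data.List.Membership.Propositional.Properties
  using (∈-∃++; ∈-map⁺; ∈-map⁻; ∈-concatMap⁻; ∈-upTo⁻; ∈-filter⁻; ∈-deduplicate⁺)
open import Data.Product using (∃₂; _×_; _,_; proj₁)
open import Function using (_∘_)
open import Data.Sum using (inj₁; inj₂)
open import Data.Empty using (⊥-elim)
open import Relation.Nullary using (contradiction)
open import Relation.Binary using (tri<; tri≈; tri>)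
open import Relation.Binary.PropositionalEquality using (_≡_; _≢_; refl; sym; trans; cong; subst; module ≡-Reasoning)

module _ {A : Set} where

  length-mono-⊆ : {xs ys : List A} → Unique xs → xs ⊆ ys → length xs ≤ length ys
  length-mono-⊆ [] _ = z≤n
  length-mono-⊆ {x ∷ xs} (x∉xs ∷ uxs) x∷xs⊆ys
    with us , vs , refl ← ∈-∃++ (x∷xs⊆ys (here refl)) = begin
      suc (length xs)         ≤⟨ s≤s (length-mono-⊆ uxs xs⊆us++vs) ⟩
      suc (length (us ++ vs)) ≡⟨ ↭-length (shift x us vs) ⟨
      length (us ++ x ∷ vs)   ∎
    where
    open ≤-Reasoning
    xs⊆us++vs : xs ⊆ us ++ vs
    xs⊆us++vs v∈xs with ∈-resp-↭ (shift x us vs) (x∷xs⊆ys (there v∈xs))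
    ... | here refl = contradiction refl (All.lookup x∉xs v∈xs)
    ... | there v∈us++vs = v∈us++vs

  map-injectiveOn⁺ : ∀ {B : Set} {f : A → B} {xs : List A} →
                     (∀ {x y} → x ∈ xs → y ∈ xs → f x ≡ f y → x ≡ y) →
                     Unique xs → Unique (map f xs)
  map-injectiveOn⁺ {xs = []} _ [] = []
  map-injectiveOn⁺ {xs = x ∷ xs} inj (x∉xs ∷ uxs) =
    All.map⁺ (All.tabulate λ y∈xs fx≡fy → All.lookup x∉xs y∈xs (inj (here refl) (there y∈xs) fx≡fy))
    ∷ map-injectiveOn⁺ (λ x∈ y∈ → inj (there x∈) (there y∈)) uxs

  map-∷-disjoint : ∀ {i j : A} {xss yss : List (List A)} → i ≢ j → Disjoint (map (i ∷_) xss) (map (j ∷_) yss)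
  map-∷-disjoint i≢j (v∈ , v∈′)
    with _ , _ , refl ← ∈-map⁻ _ v∈
    with _ , _ , refl ← ∈-map⁻ _ v∈′ = i≢j refl

prime∤1 : ∀ {p} → Prime p → p ∤ 1
prime∤1 pp p∣1 = ¬prime[1] (subst Prime (∣1⇒≡1 p∣1) pp)

prime∤! : ∀ {p m} → Prime p → m < p → p ∤ m !
prime∤! {m = zero} pp _ = prime∤1 pp
prime∤! {m = suc m} pp m<p p∣m! with euclidsLemma (suc m) (m !) pp p∣m!
... | inj₁ p∣1+m = <⇒≱ m<p (∣⇒≤ p∣1+m)
... | inj₂ p∣m! = prime∤! pp (<-trans (n<1+n m) m<p) p∣m!

prime∤factProd : ∀ {p xs} → Prime p → All (_< p) xs → p ∤ factProd xs
prime∤factProd pp [] = prime∤1 pp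
prime∤factProd {xs = x ∷ xs} pp (x<p ∷ xs<p) p∣ with euclidsLemma (x !) (factProd xs) pp p∣
... | inj₁ p∣x! = prime∤! pp x<p p∣x!
... | inj₂ p∣rest = prime∤factProd pp xs<p p∣rest

prime∣factProd-head : ∀ {p} xs → Prime p → p ∣ factProd (p ∷ xs)
prime∣factProd-head {suc p} xs _ = ∣-trans (m∣m*n (p !)) (m∣m*n (factProd xs))

factProd[<p]≢factProd[p∷ys] : ∀ {p xs} ys → Prime p → All (_< p) xs →
                               factProd xs ≢ factProd (p ∷ ys)
factProd[<p]≢factProd[p∷ys] ys pp xs<p eq =
  prime∤factProd pp xs<p (subst (_ ∣_) (sym eq) (prime∣factProd-head ys pp))

x<y⇒x∷xs<y : ∀ {x y xs} → x < y → All (x ≥_) xs → All (_< y) (x ∷ xs)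
x<y⇒x∷xs<y x<y xs≤x = x<y ∷ All.map (λ z≤x → ≤-<-trans z≤x x<y) xs≤x

factProd-injective : ∀ {xs ys} → AllPairs _≥_ xs → AllPairs _≥_ ys →
                     All Prime xs → All Prime ys → factProd xs ≡ factProd ys → xs ≡ ys
factProd-injective [] [] _ _ _ = refl
factProd-injective {ys = _ ∷ ys} [] _ _ (py ∷ _) eq =
  ⊥-elim (factProd[<p]≢factProd[p∷ys] ys py [] eq)
factProd-injective {xs = _ ∷ xs} _ [] (px ∷ _) _ eq =
  ⊥-elim (factProd[<p]≢factProd[p∷ys] xs px [] (sym eq))
factProd-injective {x ∷ xs} {y ∷ ys} (xs≤x ∷ dxs) (ys≤y ∷ dys) (px ∷ pxs) (py ∷ pys) eq
  with <-cmp x y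
... | tri< x<y _ _ = ⊥-elim (factProd[<p]≢factProd[p∷ys] ys py (x<y⇒x∷xs<y x<y xs≤x) eq)
... | tri> _ _ y<x = ⊥-elim (factProd[<p]≢factProd[p∷ys] xs px (x<y⇒x∷xs<y y<x ys≤y) (sym eq))
... | tri≈ _ refl _ =
  cong (x ∷_) (factProd-injective dxs dys pxs pys (*-cancelˡ-≡ _ _ (x !) {{x !≢0}} eq))

factProd∣sum! : ∀ xs → factProd xs ∣ sum xs !
factProd∣sum! [] = ∣-refl
factProd∣sum! (x ∷ xs) = ∣-trans (*-monoʳ-∣ (x !) (factProd∣sum! xs)) x!*[sum]!∣[x+sum]!
  where
  x!*[sum]!∣[x+sum]! : x ! * sum xs ! ∣ (x + sum xs) !
  x!*[sum]!∣[x+sum]! = subst (λ t → x ! * t ! ∣ (x + sum xs) !) (m+n∸m≡n x (sum xs))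
                               (k![n∸k]!∣n! (m≤m+n x (sum xs)))

multinomial*factProd : ∀ n xs → factProd xs ∣ n ! → multinomial n xs * factProd xs ≡ n !
multinomial*factProd n xs = m/n*n≡m {{factProd≢0 xs}}

multinomial-determines-factProd : ∀ n xs ys → factProd xs ∣ n ! → factProd ys ∣ n ! →
                                  multinomial n xs ≡ multinomial n ys → factProd xs ≡ factProd ys
multinomial-determines-factProd n xs ys xs∣n! ys∣n! eq =
  *-cancelˡ-≡ _ _ (multinomial n xs) {{multinomial≢0}} (begin
    multinomial n xs * factProd xs ≡⟨ multinomial*factProd n xs xs∣n! ⟩
    n !                            ≡⟨ multinomial*factProd n ys ys∣n! ⟨
    multinomial n ys * factProd ys ≡⟨ cong (_* factProd ys) eq ⟨
    multinomial n xs * factProd ys ∎)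
  where
  open ≡-Reasoning
  multinomial≢0 : NonZero (multinomial n xs)
  multinomial≢0 = m*n≢0⇒m≢0 _ {{subst NonZero (sym (multinomial*factProd n xs xs∣n!)) (n !≢0)}}

record IsPrimePartition (n : ℕ) (xs : List ℕ) : Set where
  field
    sum≡n          : sum xs ≡ n
    nonIncreasing  : AllPairs _≥_ xs
    allPrime       : All Prime xs

multinomial-injectiveOn-primePartitions : ∀ {n xs ys} → IsPrimePartition n xs → IsPrimePartition n ys →
                                          multinomial n xs ≡ multinomial n ys → xs ≡ ys
multinomial-injectiveOn-primePartitions {n} {xs} {ys} πx πy eq =
  factProd-injective (nonIncreasing πx) (nonIncreasing πy) (allPrime πx) (allPrime πy)
    (multinomial-determines-factProd n xs ys (factProd∣n! πx) (factProd∣n! πy) eq)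
  where
  open IsPrimePartition
  factProd∣n! : ∀ {zs} → IsPrimePartition n zs → factProd zs ∣ n !
  factProd∣n! {zs} πz = subst (λ m → factProd zs ∣ m !) (sum≡n πz) (factProd∣sum! zs)

∈-parts⁻ : ∀ f n k {xs} → xs ∈ parts (suc f) (suc n) k →
           ∃₂ λ i ys → i < k ⊓ suc n × ys ∈ parts f (n ∸ i) (suc i) × xs ≡ suc i ∷ ys
∈-parts⁻ f n k xs∈
  with i , i∈ , xs∈′ ← find (∈-concatMap⁻ (λ i → map (suc i ∷_) (parts f (n ∸ i) (suc i)))
                                            {xs = upTo (k ⊓ suc n)} xs∈)
  with ys , ys∈ , refl ← ∈-map⁻ _ xs∈′ = i , ys , ∈-upTo⁻ i∈ , ys∈ , refl

parts-sum : ∀ f n k {xs} → xs ∈ parts f n k → sum xs ≡ n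
parts-sum _ zero _ (here refl) = refl
parts-sum zero (suc n) _ ()
parts-sum (suc f) (suc n) k xs∈ with i , ys , i< , ys∈ , refl ← ∈-parts⁻ f n k xs∈ =
  trans (cong (suc i +_) (parts-sum f (n ∸ i) (suc i) ys∈)) (m+[n∸m]≡n (≤-trans i< (m⊓n≤n k (suc n))))

parts-bounded : ∀ f n k {xs} → xs ∈ parts f n k → All (_≤ k) xs
parts-bounded _ zero _ (here refl) = []
parts-bounded zero (suc n) _ ()
parts-bounded (suc f) (suc n) k xs∈ with i , ys , i< , ys∈ , refl ← ∈-parts⁻ f n k xs∈ =
  1+i≤k ∷ All.map (λ y≤1+i → ≤-trans y≤1+i 1+i≤k) (parts-bounded f (n ∸ i) (suc i) ys∈)
  where
  1+i≤k : suc i ≤ k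
  1+i≤k = ≤-trans i< (m⊓n≤m k (suc n))

parts-nonIncreasing : ∀ f n k {xs} → xs ∈ parts f n k → AllPairs _≥_ xs
parts-nonIncreasing _ zero _ (here refl) = []
parts-nonIncreasing zero (suc n) _ ()
parts-nonIncreasing (suc f) (suc n) k xs∈ with i , _ , _ , ys∈ , refl ← ∈-parts⁻ f n k xs∈ =
  parts-bounded f (n ∸ i) (suc i) ys∈ ∷ parts-nonIncreasing f (n ∸ i) (suc i) ys∈

parts-unique : ∀ f n k → Unique (parts f n k)
parts-unique _ zero _ = [] ∷ []
parts-unique zero (suc n) _ = []
parts-unique (suc f) (suc n) k =
  Unique.concat⁺ (All.map⁺ (All.tabulate λ {i} _ → Unique.map⁺ ∷-injectiveʳ (parts-unique f (n ∸ i) (suc i))))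
                 (AllPairs.map⁺ {f = branch} (AllPairs.map (λ i≢j {_} → map-∷-disjoint (i≢j ∘ suc-injective))
                                                           (Unique.upTo⁺ (k ⊓ suc n))))
  where
  branch : ℕ → List (List ℕ)
  branch i = map (suc i ∷_) (parts f (n ∸ i) (suc i))

∈-primePartitions⁻ : ∀ n {xs} → xs ∈ filter (all? prime?) (partitions n) → IsPrimePartition n xs
∈-primePartitions⁻ n xs∈ with xs∈partitions , allPrime ← ∈-filter⁻ (all? prime?) xs∈ = record
  { sum≡n         = parts-sum n n n xs∈partitions
  ; nonIncreasing = parts-nonIncreasing n n n xs∈partitions
  ; allPrime      = allPrime
  }

theorem1 : (n : ℕ) → M n ≥ pPrime n
theorem1 n = begin
  pPrime n                                     ≡⟨ length-map (multinomial n) primePartitions ⟨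
  length (map (multinomial n) primePartitions) ≤⟨ length-mono-⊆ distinctValues ⊆allValues ⟩
  M n                                          ∎
  where
  open ≤-Reasoning
  primePartitions : List (List ℕ)
  primePartitions = filter (all? prime?) (partitions n)

  distinctValues : Unique (map (multinomial n) primePartitions)
  distinctValues = map-injectiveOn⁺
    (λ x∈ y∈ → multinomial-injectiveOn-primePartitions (∈-primePartitions⁻ n x∈) (∈-primePartitions⁻ n y∈))
    (Unique.filter⁺ (all? prime?) (parts-unique n n n))

  ⊆allValues : map (multinomial n) primePartitions ⊆ deduplicate _≟_ (map (multinomial n) (partitions n))
  ⊆allValues v∈ with xs , xs∈ , refl ← ∈-map⁻ (multinomial n) v∈ =
    ∈-deduplicate⁺ _≟_ (∈-map⁺ (multinomial n) (proj₁ (∈-filter⁻ (all? prime?) xs∈)))
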